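{- Every MaxId algebra $\langle B,f\rangle$ with $|B|\ge 2$ is subdirectly irreducible.
   Context: $B$ is a Boolean algebra. A MaxId algebra is a pair $\langle B,f\rangle$ where for some $a\in B$ with $a\neq 0$, $f:B\to B$ is given by $f(0)=0$, $f(x)=a$ if $0<x\le a$, and $f(x)=1$ otherwise. Subdirect irreducibility is in the sense of universal algebra for the signature of Boolean algebras with one unary operation. -}

module Defs where

open import Level using (Level; _⊔_) renaming (suc to lsuc)
open import Algebra.Lattice.Bundles using (BooleanAlgebra)
open import Algebra.Core using (Op₁)
open import Relation.Binary.Core using (Rel)
open import Relation.Binary.Structures using (IsEquivalence)
open import Relation.Nullary using (¬_)
open import Data.Product using (Σ; ∃; _×_)

module _ {c ℓ : Level} (B : BooleanAlgebra c ℓ) where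
  open BooleanAlgebra B renaming (¬_ to ∁_)

  _≤B_ : Rel Carrier ℓ
  x ≤B y = (x ∧ y) ≈ x

  -- f is the MaxId operation determined by the element a ≠ 0:
  --   f 0 = 0,  f x = a if 0 < x ≤ a,  f x = 1 otherwise.
  -- f is an operation on the setoid carrier, so it must respect ≈.
  record IsMaxIdOp (f : Op₁ Carrier) (a : Carrier) : Set (c ⊔ ℓ) where
    field
      a≉0     : ¬ (a ≈ ⊥)
      f-cong  : ∀ {x y} → x ≈ y → f x ≈ f y
      f-zero  : f ⊥ ≈ ⊥
      f-below : ∀ x → ¬ (x ≈ ⊥) → x ≤B a → f x ≈ a
      f-other : ∀ x → ¬ (x ≈ ⊥) → ¬ (x ≤B a) → f x ≈ ⊤

  IsMaxIdAlgebra : Op₁ Carrier → Set (c ⊔ ℓ)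
  IsMaxIdAlgebra f = Σ Carrier (λ a → IsMaxIdOp f a)

  record Congruence (ℓ' : Level) (f : Op₁ Carrier) : Set (c ⊔ ℓ ⊔ lsuc ℓ') where
    field
      θ       : Rel Carrier ℓ'
      isEquiv : IsEquivalence θ
      ≈⇒θ     : ∀ {x y} → x ≈ y → θ x y
      ∨-comp  : ∀ {x y u v} → θ x y → θ u v → θ (x ∨ u) (y ∨ v)
      ∧-comp  : ∀ {x y u v} → θ x y → θ u v → θ (x ∧ u) (y ∧ v)
      ¬-comp  : ∀ {x y} → θ x y → θ (∁ x) (∁ y)
      f-comp  : ∀ {x y} → θ x y → θ (f x) (f y)

  NonIdentity : ∀ {ℓ'} {f : Op₁ Carrier} → Congruence ℓ' f → Set (c ⊔ ℓ ⊔ ℓ')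
  NonIdentity C = ∃ λ u → ∃ λ v → Congruence.θ C u v × ¬ (u ≈ v)

  -- subdirectly irreducible: the intersection of all non-identity congruences
  -- is not the identity congruence (i.e. there is a monolith); this entails
  -- nontriviality.
  SubdirectlyIrreducible : (ℓ' : Level) → Op₁ Carrier → Set (c ⊔ ℓ ⊔ lsuc ℓ')
  SubdirectlyIrreducible ℓ' f =
    ∃ λ x → ∃ λ y → ¬ (x ≈ y) ×
      ((C : Congruence ℓ' f) → NonIdentity C → Congruence.θ C x y)

  AtLeastTwo : Set (c ⊔ ℓ)
  AtLeastTwo = ∃ λ x → ∃ λ y → ¬ (x ≈ y)

{-# OPTIONS --safe #-}
-- A nonzero element d identified with 0 by a congruence θ forces θ(a, 0):
-- apply f to θ(d, 0), which gives θ(a, 0) if d ≤ a, and θ(1, 0) otherwise,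
-- and θ(1, 0) collapses everything.  Every non-identity congruence relates
-- such a d to 0, namely one of u ∧ ¬v, v ∧ ¬u for a pair θ(u, v) with u ≠ v.
-- Hence (0, a) lies in every non-identity congruence.
module Submission where

open import Defs
open import Level using (Level)
open import Algebra.Lattice.Bundles using (BooleanAlgebra)
open import Algebra.Core using (Op₁)
open import Axiom.ExcludedMiddle using (ExcludedMiddle)
open import Relation.Nullary using (yes; no; contradiction) renaming (¬_ to Not)
open import Data.Product using (∃; _×_; _,_)
import Algebra.Lattice.Properties.BooleanAlgebra as BooleanAlgebraProperties
import Relation.Binary.Reasoning.Setoid as SetoidReasoning
open import Relation.Binary.Structures using (IsEquivalence)

module _ {c ℓ : Level} (B : BooleanAlgebra c ℓ) where
  open BooleanAlgebra B renaming (¬_ to ∁_)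
  open BooleanAlgebraProperties B using (∧-identityˡ; ∧-identityʳ; ∨-identityʳ; ∧-zeroˡ)
  open SetoidReasoning setoid

  x∧∁y≈⊥⇒x≤y : ∀ {x y} → (x ∧ ∁ y) ≈ ⊥ → _≤B_ B x y
  x∧∁y≈⊥⇒x≤y {x} {y} x∧∁y≈⊥ = begin
    x ∧ y                ≈⟨ ∨-identityʳ (x ∧ y) ⟨
    (x ∧ y) ∨ ⊥          ≈⟨ ∨-congˡ x∧∁y≈⊥ ⟨
    (x ∧ y) ∨ (x ∧ ∁ y)  ≈⟨ ∧-distribˡ-∨ x y (∁ y) ⟨
    x ∧ (y ∨ ∁ y)        ≈⟨ ∧-congˡ (∨-complementʳ y) ⟩
    x ∧ ⊤                ≈⟨ ∧-identityʳ x ⟩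
    x                    ∎

  ≤B-antisym : ∀ {x y} → _≤B_ B x y → _≤B_ B y x → x ≈ y
  ≤B-antisym {x} {y} x≤y y≤x = begin
    x      ≈⟨ x≤y ⟨
    x ∧ y  ≈⟨ ∧-comm x y ⟩
    y ∧ x  ≈⟨ y≤x ⟩
    y      ∎

  module _ {ℓ' : Level} {f : Op₁ Carrier} (C : Congruence B ℓ' f) where
    open Congruence C
    open IsEquivalence isEquiv renaming (refl to θ-refl; sym to θ-sym; trans to θ-trans)

    θ⇒θ-∧∁-⊥ : ∀ {x y} → θ x y → θ (x ∧ ∁ y) ⊥
    θ⇒θ-∧∁-⊥ {y = y} θxy = θ-trans (∧-comp θxy θ-refl) (≈⇒θ (∧-complementʳ y))

    θ-⊤-⊥⇒θ-⊥ : θ ⊤ ⊥ → ∀ x → θ x ⊥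
    θ-⊤-⊥⇒θ-⊥ θ⊤⊥ x = θ-trans (≈⇒θ (sym (∧-identityˡ x)))
      (θ-trans (∧-comp θ⊤⊥ θ-refl) (≈⇒θ (∧-zeroˡ x)))

    nonIdentity⇒θ-nonzero-⊥ : ExcludedMiddle ℓ →
      NonIdentity B C → ∃ λ d → Not (d ≈ ⊥) × θ d ⊥
    nonIdentity⇒θ-nonzero-⊥ em (u , v , θuv , u≉v)
      with em {(u ∧ ∁ v) ≈ ⊥} | em {(v ∧ ∁ u) ≈ ⊥}
    ... | no u∧∁v≉⊥ | _ = u ∧ ∁ v , u∧∁v≉⊥ , θ⇒θ-∧∁-⊥ θuv
    ... | yes _ | no v∧∁u≉⊥ = v ∧ ∁ u , v∧∁u≉⊥ , θ⇒θ-∧∁-⊥ (θ-sym θuv)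
    ... | yes u∧∁v≈⊥ | yes v∧∁u≈⊥ =
      contradiction (≤B-antisym (x∧∁y≈⊥⇒x≤y u∧∁v≈⊥) (x∧∁y≈⊥⇒x≤y v∧∁u≈⊥)) u≉v

    module _ {a : Carrier} (M : IsMaxIdOp B f a) where
      open IsMaxIdOp M

      θ-f-⊥ : ∀ {d} → θ d ⊥ → θ (f d) ⊥
      θ-f-⊥ θd⊥ = θ-trans (f-comp θd⊥) (≈⇒θ f-zero)

      θ-nonzero-⊥⇒θ-a-⊥ : ExcludedMiddle ℓ → ∀ {d} → Not (d ≈ ⊥) → θ d ⊥ → θ a ⊥
      θ-nonzero-⊥⇒θ-a-⊥ em {d} d≉⊥ θd⊥ with em {_≤B_ B d a}
      ... | yes d≤a = θ-trans (≈⇒θ (sym (f-below d d≉⊥ d≤a))) (θ-f-⊥ θd⊥)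
      ... | no d≰a = θ-⊤-⊥⇒θ-⊥ (θ-trans (≈⇒θ (sym (f-other d d≉⊥ d≰a))) (θ-f-⊥ θd⊥)) a

theorem6p3 : {c ℓ ℓ' : Level} → ExcludedMiddle ℓ →
    (B : BooleanAlgebra c ℓ) (f : Op₁ (BooleanAlgebra.Carrier B)) →
    IsMaxIdAlgebra B f → AtLeastTwo B → SubdirectlyIrreducible B ℓ' f
theorem6p3 {ℓ' = ℓ'} em B f (a , M) _ = ⊥ , a , ⊥≉a , ⊥-a-in-every-nonIdentity
  where
  open BooleanAlgebra B using (_≈_; ⊥; sym)
  open IsMaxIdOp M using (a≉0)

  ⊥≉a : Not (⊥ ≈ a)
  ⊥≉a ⊥≈a = a≉0 (sym ⊥≈a)

  ⊥-a-in-every-nonIdentity : (C : Congruence B ℓ' f) → NonIdentity B C → Congruence.θ C ⊥ a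
  ⊥-a-in-every-nonIdentity C nonId =
    let (d , d≉⊥ , θd⊥) = nonIdentity⇒θ-nonzero-⊥ B C em nonId
    in IsEquivalence.sym (Congruence.isEquiv C) (θ-nonzero-⊥⇒θ-a-⊥ B C M em d≉⊥ θd⊥)
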